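{- Let $N\ge1$ and $n=\lfloor\log_2(N+1)\rfloor$. The root fires exactly $f_0(N)=\sum_{j=1}^{n-1}(2^j-1)\,c_j(N)$ times.
   Context: Unlabeled chip-firing on the infinite rooted binary tree (every vertex has a left and a right child) with a self-loop at the root. Start with $N$ indistinguishable chips at the root. A vertex with at least $3$ chips may fire, sending one chip to each child and one to its parent (the root keeps that chip via its self-loop). The process reaches a unique stable configuration, and the number of times each vertex fires is independent of the order of fires. $f_0(N)$ is the number of times the root fires. Write $N+1$ in binary as $a_na_{n-1}\dots a_1a_0$ (so $a_n=1$) and set $c_i(N)=a_i+1$ for $0\le i\le n-1$. -}

module Defs where

open import Data.Nat using (ℕ; zero; suc; _+_; _*_; _∸_; _^_; _≤_; _<_)
open import Data.Nat.DivMod using (_/_; _%_)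
open import Data.Nat.Logarithm using (⌊log₂_⌋)
open import Data.Bool using (Bool; true; false; if_then_else_)
import Data.Bool as B
open import Data.List using (List; []; _∷_; map; applyUpTo)
open import Data.Nat.ListAction using (sum)
open import Data.List.Properties using (≡-dec)
open import Relation.Nullary using (yes; no; Dec)
open import Relation.Binary.PropositionalEquality using (_≡_)

-- Vertices of the infinite rooted binary tree: paths from the root,
-- most recent step first.  [] is the root; the children of v are
-- (false ∷ v) (left) and (true ∷ v) (right); the parent of (b ∷ v) is v.
Vertex : Set
Vertex = List Bool

root : Vertex
root = []

_≟v_ : (u v : Vertex) → Dec (u ≡ v)
_≟v_ = ≡-dec B._≟_

Config : Set
Config = Vertex → ℕ

addAt : Vertex → ℕ → Config → Config
addAt v k c u with u ≟v v
... | yes _ = c u + k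
... | no  _ = c u

-- remove k chips at vertex v (truncated subtraction; only used when c v ≥ 3)
subAt : Vertex → ℕ → Config → Config
subAt v k c u with u ≟v v
... | yes _ = c u ∸ k
... | no  _ = c u

-- the vertex receiving the "parent" chip: the parent, or the root itself
-- (self-loop at the root)
parentOrSelf : Vertex → Vertex
parentOrSelf []      = []
parentOrSelf (_ ∷ v) = v

fire : Vertex → Config → Config
fire v c = addAt (parentOrSelf v) 1 (addAt (true ∷ v) 1 (addAt (false ∷ v) 1 (subAt v 3 c)))

data Run : Config → List Vertex → Config → Set where
  done : ∀ {c} → Run c [] c
  step : ∀ {c c' vs} (v : Vertex) → 3 ≤ c v → Run (fire v c) vs c' → Run c (v ∷ vs) c'

Stable : Config → Set
Stable c = ∀ v → c v < 3

initial : ℕ → Config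
initial N []      = N
initial N (_ ∷ _) = 0

rootFires : List Vertex → ℕ
rootFires []            = 0
rootFires ([] ∷ vs)     = suc (rootFires vs)
rootFires ((_ ∷ _) ∷ vs) = rootFires vs

bit : ℕ → ℕ → ℕ
bit zero    m = m % 2
bit (suc i) m = bit i (m / 2)

-- c_i(N) = a_i + 1 where N+1 = a_n ... a_0 in binary
cCoeff : ℕ → ℕ → ℕ
cCoeff N i = bit i (suc N) + 1

nOf : ℕ → ℕ
nOf N = ⌊log₂ suc N ⌋

-- Σ_{j=1}^{n-1} (2^j - 1) c_j(N)   (applyUpTo suc k = [1, …, k])
formula : ℕ → ℕ
formula N = sum (map (λ j → (2 ^ j ∸ 1) * cCoeff N j) (applyUpTo suc (nOf N ∸ 1)))

-- A firing sequence is described by its odometer p (how often each vertex fired), and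
-- c + 3p = c₀ + (chips received) determines the configuration it reaches. Least action:
-- the odometer of a legal sequence is bounded pointwise by every odometer that would
-- leave fewer than 3 chips everywhere, so all stabilizing runs fire the root equally
-- often and it suffices to exhibit one. We build a radial one, in which all vertices of
-- a depth fire together: the root fires r = ⌊(N−1)/2⌋ times, keeping 1 or 2 chips and
-- giving r to each child; each child subtree then evolves like the r-chip tree, except
-- that each chip sent up by its root is returned by one more firing of the real root.
-- So f₀(N) = r + f₀(r), which the formula satisfies because N + 1 = 2(r + 1) + a₀.

module Submission where

open import Data.Bool using (true; false)
open import Data.List using (List; []; _∷_; _++_; map; applyUpTo; length; replicate)
open import Data.Nat
open import Data.Nat.DivMod
open import Data.Nat.Induction using (<-rec)
open import Data.Nat.ListAction using (sum)
open import Data.Nat.Logarithm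
open import Data.Nat.Properties
open import Algebra.Properties.CommutativeSemigroup +-commutativeSemigroup using (interchange)
open import Data.Nat.Tactic.RingSolver using (solve-∀)
open import Data.Product using (_×_; _,_; proj₁; proj₂)
open import Data.Unit using (⊤; tt)
open import Function using (_∘_; const)
open import Relation.Binary.PropositionalEquality
open import Relation.Nullary using (yes; no; contradiction)

open import Defs

sumBelow : (ℕ → ℕ) → ℕ → ℕ
sumBelow f zero    = 0
sumBelow f (suc n) = f 0 + sumBelow (f ∘ suc) n

sum-map-applyUpTo : ∀ (g f : ℕ → ℕ) n → sum (map g (applyUpTo f n)) ≡ sumBelow (g ∘ f) n
sum-map-applyUpTo g f zero    = refl
sum-map-applyUpTo g f (suc n) = cong (g (f 0) +_) (sum-map-applyUpTo g (f ∘ suc) n)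

sumBelow-cong : ∀ {f g} n → (∀ i → f i ≡ g i) → sumBelow f n ≡ sumBelow g n
sumBelow-cong zero    f≗g = refl
sumBelow-cong (suc n) f≗g = cong₂ _+_ (f≗g 0) (sumBelow-cong n (f≗g ∘ suc))

sumBelow-+ : ∀ f g n → sumBelow (λ i → f i + g i) n ≡ sumBelow f n + sumBelow g n
sumBelow-+ f g zero    = refl
sumBelow-+ f g (suc n) = begin
  f 0 + g 0 + sumBelow (λ i → f (suc i) + g (suc i)) n   ≡⟨ cong (f 0 + g 0 +_) (sumBelow-+ (f ∘ suc) (g ∘ suc) n) ⟩
  f 0 + g 0 + (sumBelow (f ∘ suc) n + sumBelow (g ∘ suc) n) ≡⟨ interchange (f 0) (g 0) _ _ ⟩
  f 0 + sumBelow (f ∘ suc) n + (g 0 + sumBelow (g ∘ suc) n) ∎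
  where open ≡-Reasoning

sumBelow-*ˡ : ∀ k f n → sumBelow (λ i → k * f i) n ≡ k * sumBelow f n
sumBelow-*ˡ k f zero    = sym (*-zeroʳ k)
sumBelow-*ˡ k f (suc n) = trans (cong (k * f 0 +_) (sumBelow-*ˡ k (f ∘ suc) n))
                                (sym (*-distribˡ-+ k (f 0) _))

⌊log₂n⌋≡1+⌊log₂[n/2]⌋ : ∀ K → 2 ≤ K → ⌊log₂ K ⌋ ≡ suc ⌊log₂ (K / 2) ⌋
⌊log₂n⌋≡1+⌊log₂[n/2]⌋ K 2≤K = begin
  ⌊log₂ K ⌋               ≡⟨ m∸n+n≡m {⌊log₂ K ⌋} {1} 1≤log ⟨
  ⌊log₂ K ⌋ ∸ 1 + 1       ≡⟨ +-comm _ 1 ⟩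
  suc (⌊log₂ K ⌋ ∸ 1)     ≡⟨ cong suc (⌊log₂⌊n/2⌋⌋≡⌊log₂n⌋∸1 K) ⟨
  suc ⌊log₂ ⌊ K /2⌋ ⌋     ≡⟨ cong (λ h → suc ⌊log₂ h ⌋) (n/2≡⌊n/2⌋ K) ⟨
  suc ⌊log₂ (K / 2) ⌋     ∎
  where
  open ≡-Reasoning
  1≤log : 1 ≤ ⌊log₂ K ⌋
  1≤log = ⌊log₂⌋-mono-≤ {2} 2≤K
  n/2≡⌊n/2⌋ : ∀ n → n / 2 ≡ ⌊ n /2⌋
  n/2≡⌊n/2⌋ zero          = refl
  n/2≡⌊n/2⌋ (suc zero)    = refl
  n/2≡⌊n/2⌋ (suc (suc n)) = trans (m/n≡1+[m∸n]/n {suc (suc n)} {2} (s≤s (s≤s z≤n))) (cong suc (n/2≡⌊n/2⌋ n))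

1+∑2^i*[bitᵢ+1]≡n : ∀ K → 1 ≤ K → 1 + sumBelow (λ i → 2 ^ i * (bit i K + 1)) ⌊log₂ K ⌋ ≡ K
1+∑2^i*[bitᵢ+1]≡n = <-rec _ expansion
  where
  digits : ℕ → ℕ → ℕ
  digits K i = 2 ^ i * (bit i K + 1)
  expansion : ∀ K → (∀ {J} → J < K → 1 ≤ J → 1 + sumBelow (digits J) ⌊log₂ J ⌋ ≡ J)
            → 1 ≤ K → 1 + sumBelow (digits K) ⌊log₂ K ⌋ ≡ K
  expansion (suc zero)      _  _ = refl
  expansion K@(suc (suc k)) IH _ = begin
    1 + sumBelow (digits K) ⌊log₂ K ⌋
      ≡⟨ cong (λ m → 1 + sumBelow (digits K) m) (⌊log₂n⌋≡1+⌊log₂[n/2]⌋ K 2≤K) ⟩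
    1 + (1 * (K % 2 + 1) + sumBelow (digits K ∘ suc) ⌊log₂ (K / 2) ⌋)
      ≡⟨ cong (λ s → 1 + (1 * (K % 2 + 1) + s)) digits-double ⟩
    1 + (1 * (K % 2 + 1) + 2 * S)
      ≡⟨ regroup (K % 2) S ⟩
    K % 2 + (1 + S) * 2
      ≡⟨ cong (λ h → K % 2 + h * 2) (IH (m/n<m K 2 (s≤s (s≤s z≤n))) 1≤K/2) ⟩
    K % 2 + K / 2 * 2
      ≡⟨ m≡m%n+[m/n]*n K 2 ⟨
    K ∎
    where
    open ≡-Reasoning
    2≤K : 2 ≤ K
    2≤K = s≤s (s≤s z≤n)
    1≤K/2 : 1 ≤ K / 2
    1≤K/2 = subst (1 ≤_) (sym (m/n≡1+[m∸n]/n {K} {2} 2≤K)) (s≤s z≤n)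
    S : ℕ
    S = sumBelow (digits (K / 2)) ⌊log₂ (K / 2) ⌋
    digits-double : sumBelow (digits K ∘ suc) ⌊log₂ (K / 2) ⌋ ≡ 2 * S
    digits-double = trans (sumBelow-cong ⌊log₂ (K / 2) ⌋ (λ i → *-assoc 2 (2 ^ i) (bit i (K / 2) + 1)))
                          (sumBelow-*ˡ 2 (digits (K / 2)) ⌊log₂ (K / 2) ⌋)
    regroup : ∀ b s → 1 + (1 * (b + 1) + 2 * s) ≡ b + (1 + s) * 2
    regroup = solve-∀

weight : ℕ → ℕ → ℕ
weight K i = (2 ^ i ∸ 1) * (bit i K + 1)

weight-suc : ∀ K i → weight K (suc i) ≡ 2 ^ i * (bit i (K / 2) + 1) + weight (K / 2) i
weight-suc K i = [2a∸1]*y≡a*y+[a∸1]*y (2 ^ i) (m^n>0 2 i)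
  where
  [2a∸1]*y≡a*y+[a∸1]*y : ∀ a {y} → 1 ≤ a → (2 * a ∸ 1) * y ≡ a * y + (a ∸ 1) * y
  [2a∸1]*y≡a*y+[a∸1]*y (suc a) {y} _ = distrib a y
    where
    distrib : ∀ a y → (a + suc (a + 0)) * y ≡ suc a * y + a * y
    distrib = solve-∀

-- The j = 0 term vanishes, so the sum may start at 0.
formula≡∑weight : ∀ N → formula N ≡ sumBelow (weight (suc N)) ⌊log₂ suc N ⌋
formula≡∑weight N with ⌊log₂ suc N ⌋
... | zero  = refl
... | suc m = sum-map-applyUpTo (λ j → (2 ^ j ∸ 1) * cCoeff N j) suc m

-- How often the root fires before any other vertex in the radial run.
share : ℕ → ℕ
share N = (N ∸ 1) / 2

suc-share : ∀ N → 1 ≤ N → suc (share N) ≡ suc N / 2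
suc-share (suc n) _ = sym (m/n≡1+[m∸n]/n {suc (suc n)} {2} (s≤s (s≤s z≤n)))

share-< : ∀ N → 1 ≤ N → share N < N
share-< (suc n) _ = s≤s (m/n≤m n 2)

share-bounds : ∀ N → 1 ≤ N → 2 * share N + 1 ≤ N × N ≤ 2 * share N + 2
share-bounds (suc n) _ =
    subst₂ _≤_ (suc-r*2≡ r) (cong suc (sym n≡)) (s≤s (m≤n+m (r * 2) (n % 2)))
  , subst₂ _≤_ (cong suc (sym n≡)) (suc-[1+r*2]≡ r) (s≤s (+-monoˡ-≤ (r * 2) (≤-pred (m%n<n n 2))))
  where
  r : ℕ
  r = n / 2
  n≡ : n ≡ n % 2 + r * 2
  n≡ = m≡m%n+[m/n]*n n 2
  suc-r*2≡ : ∀ r → suc (r * 2) ≡ 2 * r + 1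
  suc-r*2≡ = solve-∀
  suc-[1+r*2]≡ : ∀ r → suc (1 + r * 2) ≡ 2 * r + 2
  suc-[1+r*2]≡ = solve-∀

formula-≤2 : ∀ N → N ≤ 2 → formula N ≡ 0
formula-≤2 zero                _ = refl
formula-≤2 (suc zero)          _ = refl
formula-≤2 (suc (suc zero))    _ = refl
formula-≤2 (suc (suc (suc N))) (s≤s (s≤s ()))

formula-share : ∀ N → 3 ≤ N → formula N ≡ share N + formula (share N)
formula-share N 3≤N = begin
  formula N
    ≡⟨ formula≡∑weight N ⟩
  sumBelow (weight K) ⌊log₂ K ⌋
    ≡⟨ cong (sumBelow (weight K)) (⌊log₂n⌋≡1+⌊log₂[n/2]⌋ K 2≤K) ⟩
  sumBelow (weight K ∘ suc) ⌊log₂ (K / 2) ⌋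
    ≡⟨ sumBelow-cong ⌊log₂ (K / 2) ⌋ (weight-suc K) ⟩
  sumBelow (λ i → 2 ^ i * (bit i (K / 2) + 1) + weight (K / 2) i) ⌊log₂ (K / 2) ⌋
    ≡⟨ sumBelow-+ _ (weight (K / 2)) ⌊log₂ (K / 2) ⌋ ⟩
  sumBelow (λ i → 2 ^ i * (bit i (K / 2) + 1)) ⌊log₂ (K / 2) ⌋ + sumBelow (weight (K / 2)) ⌊log₂ (K / 2) ⌋
    ≡⟨ cong (λ H → sumBelow (λ i → 2 ^ i * (bit i H + 1)) ⌊log₂ H ⌋ + sumBelow (weight H) ⌊log₂ H ⌋) (suc-share N 1≤N) ⟨
  sumBelow (λ i → 2 ^ i * (bit i (suc r) + 1)) ⌊log₂ suc r ⌋ + sumBelow (weight (suc r)) ⌊log₂ suc r ⌋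
    ≡⟨ cong₂ _+_ (suc-injective (1+∑2^i*[bitᵢ+1]≡n (suc r) (s≤s z≤n))) (sym (formula≡∑weight r)) ⟩
  r + formula r ∎
  where
  open ≡-Reasoning
  K r : ℕ
  K = suc N
  r = share N
  1≤N : 1 ≤ N
  1≤N = ≤-trans (s≤s z≤n) 3≤N
  2≤K : 2 ≤ K
  2≤K = s≤s (≤-trans (s≤s z≤n) 3≤N)

Odometer : Set
Odometer = Vertex → ℕ

-- Chips received at w when every vertex u fires p u times; the root's
-- self-loop makes the root one of its own neighbours.
inflow : Odometer → Vertex → ℕ
inflow p []      = p [] + p (false ∷ []) + p (true ∷ [])
inflow p (b ∷ v) = p (false ∷ b ∷ v) + p (true ∷ b ∷ v) + p v

inflow-+ : ∀ {p q r} → (∀ u → r u ≡ p u + q u) → ∀ w → inflow r w ≡ inflow p w + inflow q w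
inflow-+ {p} {q} {r} r≗p+q = additive
  where
  interchange₃ : ∀ a b c d e f → a + b + (c + d) + (e + f) ≡ a + c + e + (b + d + f)
  interchange₃ = solve-∀
  additive : ∀ w → inflow r w ≡ inflow p w + inflow q w
  additive [] rewrite r≗p+q [] | r≗p+q (false ∷ []) | r≗p+q (true ∷ []) =
    interchange₃ (p []) (q []) (p (false ∷ [])) (q (false ∷ [])) (p (true ∷ [])) (q (true ∷ []))
  additive (x ∷ w) rewrite r≗p+q (false ∷ x ∷ w) | r≗p+q (true ∷ x ∷ w) | r≗p+q w =
    interchange₃ (p (false ∷ x ∷ w)) (q (false ∷ x ∷ w)) (p (true ∷ x ∷ w)) (q (true ∷ x ∷ w)) (p w) (q w)

inflow-mono : ∀ {p q} → (∀ u → p u ≤ q u) → ∀ w → inflow p w ≤ inflow q w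
inflow-mono p≤q []      = +-mono-≤ (+-mono-≤ (p≤q []) (p≤q _)) (p≤q _)
inflow-mono p≤q (_ ∷ w) = +-mono-≤ (+-mono-≤ (p≤q _) (p≤q _)) (p≤q w)

δ : Vertex → Vertex → ℕ
δ []          []          = 1
δ []          (_ ∷ _)     = 0
δ (_ ∷ _)     []          = 0
δ (false ∷ v) (false ∷ w) = δ v w
δ (true ∷ v)  (true ∷ w)  = δ v w
δ (false ∷ _) (true ∷ _)  = 0
δ (true ∷ _)  (false ∷ _) = 0

δ-refl : ∀ v → δ v v ≡ 1
δ-refl []          = refl
δ-refl (false ∷ v) = δ-refl v
δ-refl (true ∷ v)  = δ-refl v

δ-≢ : ∀ v w → w ≢ v → δ v w ≡ 0
δ-≢ []          []          w≢v = contradiction refl w≢v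
δ-≢ []          (_ ∷ _)     _   = refl
δ-≢ (_ ∷ _)     []          _   = refl
δ-≢ (false ∷ v) (false ∷ w) w≢v = δ-≢ v w (w≢v ∘ cong (false ∷_))
δ-≢ (true ∷ v)  (true ∷ w)  w≢v = δ-≢ v w (w≢v ∘ cong (true ∷_))
δ-≢ (false ∷ _) (true ∷ _)  _   = refl
δ-≢ (true ∷ _)  (false ∷ _) _   = refl

inflow-δ : ∀ v w → inflow (δ v) w ≡ δ (false ∷ v) w + δ (true ∷ v) w + δ (parentOrSelf v) w
inflow-δ = adjacency
  where
  x≡x+0+0 : ∀ x → x ≡ x + 0 + 0
  x≡x+0+0 = solve-∀
  x+0+y≡y+0+x : ∀ x y → x + 0 + y ≡ y + 0 + x
  x+0+y≡y+0+x = solve-∀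
  x+0+y≡y+x : ∀ x y → x + 0 + y ≡ y + x
  x+0+y≡y+x = solve-∀
  x+y≡y+0+x : ∀ x y → x + y ≡ y + 0 + x
  x+y≡y+0+x = solve-∀
  adjacency : ∀ v w → inflow (δ v) w ≡ δ (false ∷ v) w + δ (true ∷ v) w + δ (parentOrSelf v) w
  adjacency []          []          = refl
  adjacency []          (false ∷ w) = x≡x+0+0 (δ [] w)
  adjacency []          (true ∷ w)  = sym (+-identityʳ (δ [] w))
  adjacency (false ∷ v) []          = +-identityʳ (δ v [])
  adjacency (true ∷ v)  []          = refl
  adjacency (false ∷ v) (false ∷ w) = x+0+y≡y+0+x (δ v (false ∷ w)) (δ (false ∷ v) w)
  adjacency (false ∷ v) (true ∷ w)  = x+0+y≡y+x (δ v (true ∷ w)) (δ (false ∷ v) w)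
  adjacency (true ∷ v)  (false ∷ w) = x+y≡y+0+x (δ v (false ∷ w)) (δ (true ∷ v) w)
  adjacency (true ∷ v)  (true ∷ w)  = +-comm (δ v (true ∷ w)) (δ (true ∷ v) w)

addAt-δ : ∀ v k c w → addAt v k c w ≡ c w + k * δ v w
addAt-δ v k c w with w ≟v v
... | yes refl rewrite δ-refl v | *-identityʳ k = refl
... | no  w≢v  rewrite δ-≢ v w w≢v | *-zeroʳ k = sym (+-identityʳ (c w))

subAt-δ : ∀ v k c w → subAt v k c w ≡ c w ∸ k * δ v w
subAt-δ v k c w with w ≟v v
... | yes refl rewrite δ-refl v | *-identityʳ k = refl
... | no  w≢v  rewrite δ-≢ v w w≢v | *-zeroʳ k = refl

odometer : Odometer → List Vertex → Odometer
odometer p []       = p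
odometer p (v ∷ vs) = odometer (addAt v 1 p) vs

odometer-root : ∀ p vs → odometer p vs [] ≡ p [] + rootFires vs
odometer-root p []              = sym (+-identityʳ (p []))
odometer-root p ([] ∷ vs)       = trans (odometer-root (addAt [] 1 p) vs) (+-assoc (p []) 1 _)
odometer-root p ((b ∷ v) ∷ vs)  = odometer-root (addAt (b ∷ v) 1 p) vs

module _ (c₀ : Config) where

  -- c is what c₀ becomes once every vertex u has fired p u times.
  Conserved : Config → Odometer → Set
  Conserved c p = ∀ w → c w + 3 * p w ≡ c₀ w + inflow p w

  fire-conserved : ∀ {c p} v → Conserved c p → 3 ≤ c v → Conserved (fire v c) (addAt v 1 p)
  fire-conserved {c} {p} v c≡ 3≤cv w = begin
    fire v c w + 3 * addAt v 1 p w
      ≡⟨ cong₂ (λ x y → x + 3 * y) fire-δ (addAt-δ v 1 p w) ⟩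
    c w ∸ 3 * I + 1 * F + 1 * T + 1 * P + 3 * (p w + 1 * I)
      ≡⟨ regroup (c w ∸ 3 * I) I F T P (p w) ⟩
    (c w ∸ 3 * I + 3 * I) + 3 * p w + (F + T + P)
      ≡⟨ cong₂ (λ x y → x + 3 * p w + y) (m∸n+n≡m 3I≤cw) (sym (inflow-δ v w)) ⟩
    c w + 3 * p w + inflow (δ v) w
      ≡⟨ cong (_+ inflow (δ v) w) (c≡ w) ⟩
    c₀ w + inflow p w + inflow (δ v) w
      ≡⟨ +-assoc (c₀ w) _ _ ⟩
    c₀ w + (inflow p w + inflow (δ v) w)
      ≡⟨ cong (c₀ w +_) (inflow-+ bumped≗p+δ w) ⟨
    c₀ w + inflow (addAt v 1 p) w ∎
    where
    open ≡-Reasoning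
    I F T P : ℕ
    I = δ v w
    F = δ (false ∷ v) w
    T = δ (true ∷ v) w
    P = δ (parentOrSelf v) w
    fire-δ : fire v c w ≡ c w ∸ 3 * I + 1 * F + 1 * T + 1 * P
    fire-δ = trans (addAt-δ (parentOrSelf v) 1 _ w) (cong (_+ 1 * P)
            (trans (addAt-δ (true ∷ v) 1 _ w) (cong (_+ 1 * T)
            (trans (addAt-δ (false ∷ v) 1 _ w) (cong (_+ 1 * F) (subAt-δ v 3 c w))))))
    bumped≗p+δ : ∀ u → addAt v 1 p u ≡ p u + δ v u
    bumped≗p+δ u = trans (addAt-δ v 1 p u) (cong (p u +_) (*-identityˡ (δ v u)))
    3I≤cw : 3 * I ≤ c w
    3I≤cw with w ≟v v
    ... | yes refl rewrite δ-refl v = 3≤cv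
    ... | no  w≢v  rewrite δ-≢ v w w≢v = z≤n
    regroup : ∀ a i f t q x → a + 1 * f + 1 * t + 1 * q + 3 * (x + 1 * i) ≡ (a + 3 * i) + 3 * x + (f + t + q)
    regroup = solve-∀

  Firable : Odometer → Vertex → Set
  Firable p v = 3 + 3 * p v ≤ c₀ v + inflow p v

  Legal : Odometer → List Vertex → Set
  Legal p []       = ⊤
  Legal p (v ∷ vs) = Firable p v × Legal (addAt v 1 p) vs

  Stabilizing : Odometer → Set
  Stabilizing u = ∀ w → c₀ w + inflow u w < 3 + 3 * u w

  run⇒legal : ∀ {c vs c'} → Run c vs c' → ∀ {p} → Conserved c p → Legal p vs × Conserved c' (odometer p vs)
  run⇒legal done                  c≡ = tt , c≡
  run⇒legal {c} (step v 3≤cv run) {p} c≡ =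
    let legal , c'≡ = run⇒legal run (fire-conserved v c≡ 3≤cv)
    in  (subst (3 + 3 * p v ≤_) (c≡ v) (+-monoˡ-≤ (3 * p v) 3≤cv) , legal) , c'≡

  stable⇒stabilizing : ∀ {c u} → Stable c → Conserved c u → Stabilizing u
  stable⇒stabilizing {c} {u} stable c≡ w = subst (_< 3 + 3 * u w) (c≡ w) (+-monoˡ-< (3 * u w) (stable w))

  firable⇒< : ∀ {p u v} → (∀ w → p w ≤ u w) → Stabilizing u → Firable p v → p v < u v
  firable⇒< {p} {u} {v} p≤u stab firable = *-cancelˡ-< 3 (p v) (u v) (+-cancelˡ-< 3 (3 * p v) (3 * u v)
    (≤-<-trans firable (≤-<-trans (+-monoʳ-≤ (c₀ v) (inflow-mono p≤u v)) (stab v))))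

  leastAction : ∀ {p u} vs → Legal p vs → (∀ w → p w ≤ u w) → Stabilizing u → ∀ w → odometer p vs w ≤ u w
  leastAction []       _                p≤u stab = p≤u
  leastAction {p} {u} (v ∷ vs) (firable , legal) p≤u stab = leastAction vs legal bumped≤u stab
    where
    bumped≤u : ∀ w → addAt v 1 p w ≤ u w
    bumped≤u w with w ≟v v
    ... | yes refl = subst (_≤ u v) (+-comm 1 (p v)) (firable⇒< p≤u stab firable)
    ... | no  _    = p≤u w

-- Radial odometers: firings per vertex at each depth; bump d fires every vertex of depth d.
Profile : Set
Profile = ℕ → ℕ

bump : ℕ → Profile → Profile
bump d P e with e ≟ d
... | yes _ = suc (P e)
... | no  _ = P e

radialOdometer : Profile → List ℕ → Profile
radialOdometer P []       = P
radialOdometer P (d ∷ ds) = radialOdometer (bump d P) ds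

initialʳ : ℕ → Profile
initialʳ N zero    = N
initialʳ N (suc _) = 0

inflowʳ : Profile → ℕ → ℕ
inflowʳ P zero    = P 0 + P 1 + P 1
inflowʳ P (suc d) = P (suc (suc d)) + P (suc (suc d)) + P d

module _ (N : ℕ) where

  Firableʳ : Profile → ℕ → Set
  Firableʳ P d = 3 + 3 * P d ≤ initialʳ N d + inflowʳ P d

  Legalʳ : Profile → List ℕ → Set
  Legalʳ P []       = ⊤
  Legalʳ P (d ∷ ds) = Firableʳ P d × Legalʳ (bump d P) ds

  Stabilizingʳ : Profile → Set
  Stabilizingʳ U = ∀ d → initialʳ N d + inflowʳ U d < 3 + 3 * U d

  firableʳ⇒firable : ∀ P w → Firableʳ P (length w) → Firable (initial N) (P ∘ length) w
  firableʳ⇒firable P []      firable = firable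
  firableʳ⇒firable P (_ ∷ _) firable = firable

  stabilizingʳ⇒stabilizing : ∀ {U} → Stabilizingʳ U → Stabilizing (initial N) (U ∘ length)
  stabilizingʳ⇒stabilizing stab []      = stab 0
  stabilizingʳ⇒stabilizing stab (_ ∷ ws) = stab (suc (length ws))

  radialLeastAction : ∀ {P u} ds → Legalʳ P ds → (∀ w → P (length w) ≤ u w) → Stabilizing (initial N) u
                    → ∀ w → radialOdometer P ds (length w) ≤ u w
  radialLeastAction []       _                P≤u stab = P≤u
  radialLeastAction {P} {u} (d ∷ ds) (firable , legal) P≤u stab = radialLeastAction ds legal bumped≤u stab
    where
    bumped≤u : ∀ w → bump d P (length w) ≤ u w
    bumped≤u w with length w ≟ d
    ... | yes refl = firable⇒< (initial N) P≤u stab (firableʳ⇒firable P w firable)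
    ... | no  _    = P≤u w

Legalʳ-++ : ∀ {N P} ds es → Legalʳ N P ds → Legalʳ N (radialOdometer P ds) es → Legalʳ N P (ds ++ es)
Legalʳ-++ []       es _                 legal′ = legal′
Legalʳ-++ (d ∷ ds) es (firable , legal) legal′ = firable , Legalʳ-++ ds es legal legal′

radialOdometer-++ : ∀ P ds es → radialOdometer P (ds ++ es) ≡ radialOdometer (radialOdometer P ds) es
radialOdometer-++ P []       es = refl
radialOdometer-++ P (d ∷ ds) es = radialOdometer-++ (bump d P) ds es

Stabilizingʳ-cong : ∀ {N U V} → (∀ d → U d ≡ V d) → Stabilizingʳ N V → Stabilizingʳ N U
Stabilizingʳ-cong U≗V stab zero    rewrite U≗V 0 | U≗V 1 = stab 0
Stabilizingʳ-cong U≗V stab (suc d) rewrite U≗V (suc (suc d)) | U≗V d | U≗V (suc d) = stab (suc d)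

deepenProfile : ℕ → Profile → Profile
deepenProfile r P zero    = r + P 0
deepenProfile r P (suc d) = P d

inflowʳ-deepenProfile-1 : ∀ r P → inflowʳ (deepenProfile r P) 1 ≡ r + inflowʳ P 0
inflowʳ-deepenProfile-1 r P = rearrange r (P 0) (P 1)
  where
  rearrange : ∀ r a b → b + b + (r + a) ≡ r + (a + b + b)
  rearrange = solve-∀

-- After j root firings, and none elsewhere, the root holds N − 2j chips.
fireRoot : ∀ {N} k {j P} → (∀ d → P d ≡ deepenProfile j (const 0) d) → 2 * (j + k) + 1 ≤ N
         → Legalʳ N P (replicate k 0) × (∀ d → radialOdometer P (replicate k 0) d ≡ deepenProfile (j + k) (const 0) d)
fireRoot zero {j} P≗ _ = tt , λ d → trans (P≗ d) (cong (λ x → deepenProfile x (const 0) d) (sym (+-identityʳ j)))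
fireRoot {N} (suc k) {j} {P} P≗ bound =
  let legal , P′≗ = fireRoot k bumped≗ (subst (λ x → 2 * x + 1 ≤ N) (+-suc j k) bound)
  in  (firable , legal) , λ d → trans (P′≗ d) (cong (λ x → deepenProfile x (const 0) d) (sym (+-suc j k)))
  where
  bumped≗ : ∀ d → bump 0 P d ≡ deepenProfile (suc j) (const 0) d
  bumped≗ zero    = cong suc (P≗ 0)
  bumped≗ (suc d) = P≗ (suc d)
  firable : 3 + 3 * P 0 ≤ N + (P 0 + P 1 + P 1)
  firable rewrite P≗ 0 | P≗ 1 =
    subst (_≤ N + (j + 0 + 0 + 0)) (rearrange j) (+-monoˡ-≤ _ (≤-trans (3+2j≤2[j+1+k]+1 j k) bound))
    where
    rearrange : ∀ j → 3 + 2 * j + (j + 0 + 0 + 0) ≡ 3 + 3 * (j + 0)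
    rearrange = solve-∀
    3+2j≤2[j+1+k]+1 : ∀ j k → 3 + 2 * j ≤ 2 * (j + suc k) + 1
    3+2j≤2[j+1+k]+1 j k = subst (3 + 2 * j ≤_) (expand j k) (m≤m+n (3 + 2 * j) (2 * k))
      where
      expand : ∀ j k → 3 + 2 * j + 2 * k ≡ 2 * (j + suc k) + 1
      expand = solve-∀

-- Runs the r-chip tree in both subtrees of the root. A root firing there (depth 0) becomes
-- a firing at depth 1 followed by one root firing, which returns the chips sent up.
deepen : List ℕ → List ℕ
deepen []           = []
deepen (zero ∷ ds)  = 1 ∷ 0 ∷ deepen ds
deepen (suc d ∷ ds) = suc (suc d) ∷ deepen ds

deepen-legal : ∀ {N r} ds {P Q} → 2 * r + 1 ≤ N → (∀ d → Q d ≡ deepenProfile r P d) → Legalʳ r P ds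
             → Legalʳ N Q (deepen ds) × (∀ d → radialOdometer Q (deepen ds) d ≡ deepenProfile r (radialOdometer P ds) d)
deepen-legal []           _     Q≗ _                 = tt , Q≗
deepen-legal {N} {r} (zero ∷ ds) {P} {Q} bound Q≗ (firable , legal) =
  let legal′ , Q′≗ = deepen-legal ds bound Q′≗P′ legal
  in  (firable₁ , firable₀ , legal′) , Q′≗
  where
  Q′≗P′ : ∀ d → bump 0 (bump 1 Q) d ≡ deepenProfile r (bump 0 P) d
  Q′≗P′ zero          rewrite Q≗ 0          = sym (+-suc r (P 0))
  Q′≗P′ (suc zero)    rewrite Q≗ 1          = refl
  Q′≗P′ (suc (suc d)) rewrite Q≗ (suc (suc d)) = refl
  firable₁ : 3 + 3 * Q 1 ≤ 0 + (Q 2 + Q 2 + Q 0)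
  firable₁ rewrite Q≗ 0 | Q≗ 1 | Q≗ 2 = subst (3 + 3 * P 0 ≤_) (sym (inflowʳ-deepenProfile-1 r P)) firable
  firable₀ : 3 + 3 * Q 0 ≤ N + (Q 0 + suc (Q 1) + suc (Q 1))
  firable₀ rewrite Q≗ 0 | Q≗ 1 = subst (_≤ N + (r + P 0 + suc (P 0) + suc (P 0))) (rearrange r (P 0)) (+-monoˡ-≤ _ bound)
    where
    rearrange : ∀ r a → 2 * r + 1 + (r + a + suc a + suc a) ≡ 3 + 3 * (r + a)
    rearrange = solve-∀
deepen-legal {N} {r} (suc e ∷ ds) {P} {Q} bound Q≗ (firable , legal) =
  let legal′ , Q′≗ = deepen-legal ds bound Q′≗P′ legal
  in  (firable′ , legal′) , Q′≗
  where
  Q′≗P′ : ∀ d → bump (suc (suc e)) Q d ≡ deepenProfile r (bump (suc e) P) d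
  Q′≗P′ zero    rewrite Q≗ 0       = refl
  Q′≗P′ (suc d) with suc d ≟ suc (suc e) | d ≟ suc e
  ... | yes _    | yes _   = cong suc (Q≗ (suc d))
  ... | no  _    | no  _   = Q≗ (suc d)
  ... | yes eq   | no  ¬eq = contradiction (suc-injective eq) ¬eq
  ... | no  ¬eq  | yes eq  = contradiction (cong suc eq) ¬eq
  firable′ : 3 + 3 * Q (suc (suc e)) ≤ 0 + (Q (3 + e) + Q (3 + e) + Q (suc e))
  firable′ rewrite Q≗ (suc (suc e)) | Q≗ (3 + e) | Q≗ (suc e) = firable

rootThenDeepen : ∀ {N r} ds → 2 * r + 1 ≤ N → Legalʳ r (const 0) ds
               → Legalʳ N (const 0) (replicate r 0 ++ deepen ds)
               × (∀ d → radialOdometer (const 0) (replicate r 0 ++ deepen ds) d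
                      ≡ deepenProfile r (radialOdometer (const 0) ds) d)
rootThenDeepen {r = r} ds bound legal =
  let rootLegal , afterRoot≗ = fireRoot r {0} {const 0} (λ { zero → refl ; (suc _) → refl }) bound
      deepLegal , final≗     = deepen-legal ds bound afterRoot≗ legal
  in  Legalʳ-++ (replicate r 0) (deepen ds) rootLegal deepLegal
    , λ d → trans (cong (λ P → P d) (radialOdometer-++ (const 0) (replicate r 0) (deepen ds))) (final≗ d)

Stabilizingʳ-deepen : ∀ {N r U} → N ≤ 2 * r + 2 → Stabilizingʳ r U → Stabilizingʳ N (deepenProfile r U)
Stabilizingʳ-deepen {N} {r} {U} bound stab zero =
  subst (suc (N + X) ≤_) (rearrange r (U 0)) (+-monoˡ-≤ X (s≤s bound))
  where
  X : ℕ
  X = r + U 0 + U 0 + U 0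
  rearrange : ∀ r a → suc (2 * r + 2) + (r + a + a + a) ≡ 3 + 3 * (r + a)
  rearrange = solve-∀
Stabilizingʳ-deepen {r = r} {U} bound stab (suc zero) =
  subst (_< 3 + 3 * U 0) (sym (inflowʳ-deepenProfile-1 r U)) (stab 0)
Stabilizingʳ-deepen bound stab (suc (suc d)) = stab (suc d)

record RadialStabilization (N : ℕ) : Set where
  field
    firings     : List ℕ
    legal       : Legalʳ N (const 0) firings
    stabilizing : Stabilizingʳ N (radialOdometer (const 0) firings)
    rootFirings : radialOdometer (const 0) firings 0 ≡ formula N

radialStabilization-≤2 : ∀ {N} → N ≤ 2 → RadialStabilization N
radialStabilization-≤2 {N} N≤2 = record
  { firings = [] ; legal = tt ; stabilizing = stabilizing ; rootFirings = sym (formula-≤2 N N≤2) }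
  where
  stabilizing : Stabilizingʳ N (const 0)
  stabilizing zero    = s≤s (subst (_≤ 2) (sym (+-identityʳ N)) N≤2)
  stabilizing (suc d) = s≤s z≤n

radialStabilization-share : ∀ {N} → 3 ≤ N → RadialStabilization (share N) → RadialStabilization N
radialStabilization-share {N} 3≤N S = record
  { firings     = replicate r 0 ++ deepen S.firings
  ; legal       = proj₁ phases
  ; stabilizing = Stabilizingʳ-cong (proj₂ phases) (Stabilizingʳ-deepen (proj₂ bounds) S.stabilizing)
  ; rootFirings = trans (proj₂ phases 0) (trans (cong (r +_) S.rootFirings) (sym (formula-share N 3≤N)))
  }
  where
  module S = RadialStabilization S
  r : ℕ
  r = share N
  bounds : 2 * r + 1 ≤ N × N ≤ 2 * r + 2
  bounds = share-bounds N (≤-trans (s≤s z≤n) 3≤N)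
  phases : Legalʳ N (const 0) (replicate r 0 ++ deepen S.firings)
         × (∀ d → radialOdometer (const 0) (replicate r 0 ++ deepen S.firings) d
                ≡ deepenProfile r (radialOdometer (const 0) S.firings) d)
  phases = rootThenDeepen S.firings (proj₁ bounds) S.legal

radialStabilization : ∀ N → RadialStabilization N
radialStabilization = <-rec RadialStabilization build
  where
  build : ∀ N → (∀ {M} → M < N → RadialStabilization M) → RadialStabilization N
  build N rec with N ≤? 2
  ... | yes N≤2 = radialStabilization-≤2 N≤2
  ... | no  N≰2 = radialStabilization-share (≰⇒> N≰2) (rec (share-< N (≤-trans (s≤s z≤n) (≰⇒> N≰2))))

conserved₀ : ∀ N → Conserved (initial N) (initial N) (const 0)
conserved₀ N []      = refl
conserved₀ N (_ ∷ _) = refl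

mainTheorem15 : (N : ℕ) → 1 ≤ N → (vs : List Vertex) → (c : Config)
    → Run (initial N) vs c → Stable c → rootFires vs ≡ formula N
mainTheorem15 N _ vs c run stable = begin
  rootFires vs                          ≡⟨ odometer-root (const 0) vs ⟨
  odometer (const 0) vs []              ≡⟨ ≤-antisym (runBelowRadial []) (radialBelowRun []) ⟩
  radialOdometer (const 0) R.firings 0  ≡⟨ R.rootFirings ⟩
  formula N                             ∎
  where
  open ≡-Reasoning
  module R = RadialStabilization (radialStabilization N)
  runAccounted : Legal (initial N) (const 0) vs × Conserved (initial N) c (odometer (const 0) vs)
  runAccounted = run⇒legal (initial N) run (conserved₀ N)
  runBelowRadial : ∀ w → odometer (const 0) vs w ≤ radialOdometer (const 0) R.firings (length w)
  runBelowRadial = leastAction (initial N) vs (proj₁ runAccounted) (λ _ → z≤n)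
                     (stabilizingʳ⇒stabilizing N R.stabilizing)
  radialBelowRun : ∀ w → radialOdometer (const 0) R.firings (length w) ≤ odometer (const 0) vs w
  radialBelowRun = radialLeastAction N R.firings R.legal (λ _ → z≤n)
                     (stable⇒stabilizing (initial N) stable (proj₂ runAccounted))
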